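{- Let $n>2$. The only additive game on $\mathfrak{C}(n)_\bot$ is the constant game $v=0$.
   Context: Let $N=\{1,\dots,n\}$. An embedded subset is a pair $(S,\pi)$ with $S\subseteq N$ nonempty and $\pi$ a partition of $N$ having $S$ as a block. $\mathfrak{C}(n)_\bot$ is the set of embedded subsets together with an added least element $\bot$, ordered by $(S,\pi)\sqsubseteq(S',\pi')$ iff $S\subseteq S'$ and $\pi$ refines $\pi'$; it is a lattice. A game on $\mathfrak{C}(n)_\bot$ is a function $v:\mathfrak{C}(n)_\bot\to\mathbb{R}$ with $v(\bot)=0$. It is additive if $v(x\vee y)+v(x\wedge y)=v(x)+v(y)$ for all $x,y$ (i.e., it is both supermodular and submodular). -}

module Defs where

open import Level using (Level; _⊔_) renaming (suc to lsuc)
open import Data.Nat using (ℕ; zero; suc)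
open import Data.Bool using (Bool; true; false)
open import Data.Fin using (Fin)
open import Data.Fin.Subset using (Subset; _∈_; _⊆_)
open import Data.Product using (Σ; ∃; _×_; _,_)
open import Data.Empty using (⊥)
open import Data.Unit using (⊤)
open import Relation.Binary.PropositionalEquality using (_≡_)
open import Algebra.Bundles using (AbelianGroup)

record Partition (n : ℕ) : Set where
  field
    rel    : Fin n → Fin n → Bool
    rel-refl  : ∀ i → rel i i ≡ true
    rel-sym   : ∀ i j → rel i j ≡ true → rel j i ≡ true
    rel-trans : ∀ i j k → rel i j ≡ true → rel j k ≡ true → rel i k ≡ true
open Partition public

_Refines_ : ∀ {n} → Partition n → Partition n → Set
π Refines π' = ∀ i j → rel π i j ≡ true → rel π' i j ≡ true

record Embedded (n : ℕ) : Set where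
  field
    set      : Subset n
    part     : Partition n
    nonempty : ∃ λ i → i ∈ set
    isBlock  : ∀ i → i ∈ set → ∀ j →
                 (j ∈ set → rel part i j ≡ true) × (rel part i j ≡ true → j ∈ set)
open Embedded public

data C⊥ (n : ℕ) : Set where
  bot : C⊥ n
  emb : Embedded n → C⊥ n

_⊑_ : ∀ {n} → C⊥ n → C⊥ n → Set
bot   ⊑ _     = ⊤
emb x ⊑ bot   = ⊥
emb x ⊑ emb y = (set x ⊆ set y) × (part x Refines part y)

IsJoin : ∀ {n} → C⊥ n → C⊥ n → C⊥ n → Set
IsJoin j x y = (x ⊑ j) × (y ⊑ j) × (∀ z → x ⊑ z → y ⊑ z → j ⊑ z)

IsMeet : ∀ {n} → C⊥ n → C⊥ n → C⊥ n → Set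
IsMeet m x y = (m ⊑ x) × (m ⊑ y) × (∀ z → z ⊑ x → z ⊑ y → z ⊑ m)

module _ {c ℓ : Level} (G : AbelianGroup c ℓ) where
  open AbelianGroup G

  times : ℕ → Carrier → Carrier
  times zero    x = ε
  times (suc k) x = x ∙ times k x

  TorsionFree : Set (c ⊔ ℓ)
  TorsionFree = ∀ k x → times (suc k) x ≈ ε → x ≈ ε

  IsGame : ∀ {n} → (C⊥ n → Carrier) → Set ℓ
  IsGame v = v bot ≈ ε

  IsAdditive : ∀ {n} → (C⊥ n → Carrier) → Set ℓ
  IsAdditive {n} v = ∀ (x y j m : C⊥ n) → IsJoin j x y → IsMeet m x y →
                     (v j ∙ v m) ≈ (v x ∙ v y)

-- Write a_k for the value of ({k}, {{k}, N∖{k}}) and w_i for that of ({i}, discrete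
-- partition). An embedded subset x missing k meets ({k}, {{k}, N∖{k}}) in ⊥ and joins
-- it to the top (N, {N}), so additivity gives v(top) = v(x) + a_k. With three distinct
-- points p, q, r the two singletons {p}, {q} (discrete) join to {p, q} (discrete) and
-- meet in ⊥; comparing the decompositions of v(top) through r forces w_q = 0. Then
-- v(top) = w_q + a_k = a_k for k ≠ q, in particular v(top) = a_p + a_r = 2 v(top), so
-- v(top) = 0, every a_k vanishes, and hence so does every v(x).
module Submission where

open import Defs
open import Level using (Level)
open import Data.Nat using (ℕ; _<_; suc; s≤s; _≡ᵇ_)
open import Data.Nat.Properties using (≡ᵇ⇒≡; ≡⇒≡ᵇ; suc-injective)
open import Algebra.Bundles using (AbelianGroup)
open import Data.Bool using (true; if_then_else_)
open import Data.Bool.Properties using (T-≡)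
open import Data.Fin using (Fin; toℕ) renaming (zero to fzero; suc to fsuc)
open import Data.Fin.Properties using (_≟_; toℕ-injective; all?; ¬∀⟶∃¬)
open import Data.Fin.Subset using (Subset; _∈_; _∉_; _⊆_; _∪_; ⁅_⁆; ⊤)
open import Data.Fin.Subset.Properties
  using (_∈?_; ∈⊤; x∈⁅x⁆; x∈⁅y⁆⇒x≡y; x≢y⇒x∉⁅y⁆; p⊆p∪q; q⊆p∪q; x∈p∪q⁻)
open import Data.Product using (∃; _×_; _,_; proj₁; proj₂)
open import Data.Sum using (_⊎_; inj₁; inj₂; [_,_])
open import Data.Unit using (tt)
open import Function.Base using (_∘_)
open import Function.Bundles using (Equivalence)
open import Relation.Nullary using (does; yes; no; contradiction)
open import Relation.Binary.PropositionalEquality as ≡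
  using (_≡_; _≢_; refl; cong; subst)

≡ᵇ-sound : ∀ m n → (m ≡ᵇ n) ≡ true → m ≡ n
≡ᵇ-sound m n p = ≡ᵇ⇒≡ m n (Equivalence.from T-≡ p)

≡ᵇ-complete : ∀ m n → m ≡ n → (m ≡ᵇ n) ≡ true
≡ᵇ-complete m n p = Equivalence.to T-≡ (≡⇒≡ᵇ m n p)

module _ {n : ℕ} where

  fibres : (Fin n → ℕ) → Partition n
  fibres ℓ = record
    { rel       = λ a b → ℓ a ≡ᵇ ℓ b
    ; rel-refl  = λ a → ≡ᵇ-complete (ℓ a) (ℓ a) refl
    ; rel-sym   = λ a b p → ≡ᵇ-complete (ℓ b) (ℓ a) (≡.sym (≡ᵇ-sound (ℓ a) (ℓ b) p))
    ; rel-trans = λ a b c p q → ≡ᵇ-complete (ℓ a) (ℓ c)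
                    (≡.trans (≡ᵇ-sound (ℓ a) (ℓ b) p) (≡ᵇ-sound (ℓ b) (ℓ c) q))
    }

  label : Subset n → (Fin n → ℕ) → Fin n → ℕ
  label S f a = if does (a ∈? S) then 0 else suc (f a)

  label-∈ : ∀ {S} f {a} → a ∈ S → label S f a ≡ 0
  label-∈ {S} f {a} a∈S with a ∈? S
  ... | yes _   = refl
  ... | no a∉S = contradiction a∈S a∉S

  label-∉ : ∀ {S} f {a} → a ∉ S → label S f a ≡ suc (f a)
  label-∉ {S} f {a} a∉S with a ∈? S
  ... | yes a∈S = contradiction a∈S a∉S
  ... | no _    = refl

  label≡0⇒∈ : ∀ {S} f {a} → label S f a ≡ 0 → a ∈ S
  label≡0⇒∈ {S} f {a} p with a ∈? S
  ... | yes a∈S = a∈S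

  -- The embedded subset (S, π) where the blocks of π off S are the fibres of f.
  blockWith : (S : Subset n) → ∃ (_∈ S) → (Fin n → ℕ) → Embedded n
  blockWith S s f = record
    { set      = S
    ; part     = fibres (label S f)
    ; nonempty = s
    ; isBlock  = λ i i∈S j →
        (λ j∈S → ≡ᵇ-complete (label S f i) (label S f j)
                   (≡.trans (label-∈ f i∈S) (≡.sym (label-∈ f j∈S))))
      , (λ r → label≡0⇒∈ f (≡.trans (≡.sym (≡ᵇ-sound (label S f i) (label S f j) r))
                                   (label-∈ f i∈S)))
    }

  label≡label⇒ : ∀ {S f a b} → label S f a ≡ label S f b → (a ∈ S × b ∈ S) ⊎ f a ≡ f b
  label≡label⇒ {S} {f} {a} {b} eq with a ∈? S | b ∈? S
  label≡label⇒ eq  | yes a∈S | yes b∈S = inj₁ (a∈S , b∈S)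
  label≡label⇒ ()  | yes _   | no _
  label≡label⇒ ()  | no _    | yes _
  label≡label⇒ eq  | no _    | no _    = inj₂ (suc-injective eq)

  fibres-label⁻ : ∀ S f {a b} → rel (fibres (label S f)) a b ≡ true →
                  (a ∈ S × b ∈ S) ⊎ f a ≡ f b
  fibres-label⁻ S f {a} {b} r = label≡label⇒ (≡ᵇ-sound (label S f a) (label S f b) r)

  fibres-label⁺ : ∀ S f {a b} → a ∉ S → b ∉ S → f a ≡ f b →
                  rel (fibres (label S f)) a b ≡ true
  fibres-label⁺ S f {a} {b} a∉S b∉S eq = ≡ᵇ-complete (label S f a) (label S f b) (begin
    label S f a  ≡⟨ label-∉ f a∉S ⟩
    suc (f a)    ≡⟨ cong suc eq ⟩
    suc (f b)    ≡⟨ label-∉ f b∉S ⟨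
    label S f b  ∎)
    where open ≡.≡-Reasoning

  top : Fin n → Embedded n
  top t = blockWith ⊤ (t , ∈⊤) toℕ

  -- ({k}, {{k}, N∖{k}})
  split : Fin n → Embedded n
  split k = blockWith ⁅ k ⁆ (k , x∈⁅x⁆ k) (λ _ → 0)

  -- (S, {S} ∪ singletons)
  discrete : (S : Subset n) → ∃ (_∈ S) → Embedded n
  discrete S s = blockWith S s toℕ

  singleton : Fin n → Embedded n
  singleton i = discrete ⁅ i ⁆ (i , x∈⁅x⁆ i)

  pair : Fin n → Fin n → Embedded n
  pair i j = discrete (⁅ i ⁆ ∪ ⁅ j ⁆) (i , p⊆p∪q ⁅ j ⁆ (x∈⁅x⁆ i))

  ∉⇒disjoint-⁅⁆ : ∀ {S : Subset n} {k a} → k ∉ S → a ∈ S → a ∉ ⁅ k ⁆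
  ∉⇒disjoint-⁅⁆ {S} k∉S a∈S a∈k = k∉S (subst (_∈ S) (x∈⁅y⁆⇒x≡y _ a∈k) a∈S)

  ≢⇒disjoint-⁅⁆ : ∀ {i j a : Fin n} → i ≢ j → a ∈ ⁅ i ⁆ → a ∉ ⁅ j ⁆
  ≢⇒disjoint-⁅⁆ {i} {j} i≢j a∈i a∈j =
    i≢j (≡.trans (≡.sym (x∈⁅y⁆⇒x≡y i a∈i)) (x∈⁅y⁆⇒x≡y j a∈j))

  ⊑-refl : (x : C⊥ n) → x ⊑ x
  ⊑-refl bot     = tt
  ⊑-refl (emb x) = (λ a∈ → a∈) , (λ a b r → r)

  ⊑-full : ∀ e → (∀ a → a ∈ set e) → (x : Embedded n) → emb x ⊑ emb e
  ⊑-full e full x =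
    (λ {a} _ → full a) , (λ a b _ → proj₁ (isBlock e a (full a) b) (full b))

  ⊑-discrete : ∀ {S s} e → S ⊆ set e → emb (discrete S s) ⊑ emb e
  ⊑-discrete {S} {s} e S⊆e = S⊆e , refines
    where
    refines : part (discrete S s) Refines part e
    refines a b r with fibres-label⁻ S toℕ r
    ... | inj₁ (a∈S , b∈S) = proj₁ (isBlock e a (S⊆e a∈S) b) (S⊆e b∈S)
    ... | inj₂ toℕa≡toℕb with toℕ-injective {i = a} {j = b} toℕa≡toℕb
    ...   | refl = rel-refl (part e) a

  disjoint⇒isMeet-bot : ∀ {x y : Embedded n} → (∀ {a} → a ∈ set x → a ∉ set y) →
                        IsMeet bot (emb x) (emb y)
  disjoint⇒isMeet-bot disjoint = tt , tt , greatest
    where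
    greatest : ∀ z → z ⊑ emb _ → z ⊑ emb _ → z ⊑ bot
    greatest bot     _        _        = tt
    greatest (emb e) (e⊆x , _) (e⊆y , _) =
      disjoint (e⊆x (proj₂ (nonempty e))) (e⊆y (proj₂ (nonempty e)))

  full⇒isJoin-top : ∀ t {e} → (∀ a → a ∈ set e) → IsJoin (emb (top t)) (emb e) (emb e)
  full⇒isJoin-top t {e} full =
    ⊑-full (top t) (λ _ → ∈⊤) e , ⊑-full (top t) (λ _ → ∈⊤) e , least
    where
    least : ∀ z → emb e ⊑ z → emb e ⊑ z → emb (top t) ⊑ z
    least (emb e′) (e⊆e′ , _) _ = ⊑-full e′ (λ a → e⊆e′ (full a)) (top t)

  -- The complement of {k} is one block of split k, and x puts a point of it into the
  -- upper bound's distinguished block, so that block is all of N.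
  ∉⇒isJoin-top : ∀ t {x k} → k ∉ set x → IsJoin (emb (top t)) (emb x) (emb (split k))
  ∉⇒isJoin-top t {x} {k} k∉x =
    ⊑-full (top t) (λ _ → ∈⊤) x , ⊑-full (top t) (λ _ → ∈⊤) (split k) , least
    where
    s = proj₁ (nonempty x)
    s∈x = proj₂ (nonempty x)
    least : ∀ z → emb x ⊑ z → emb (split k) ⊑ z → emb (top t) ⊑ z
    least (emb e) (x⊆e , _) (k⊆e , split⊑e) = ⊑-full e full (top t)
      where
      full : ∀ a → a ∈ set e
      full a with a ≟ k
      ... | yes refl = k⊆e (x∈⁅x⁆ k)
      ... | no a≢k   = proj₂ (isBlock e s (x⊆e s∈x) a) (split⊑e s a
            (fibres-label⁺ ⁅ k ⁆ (λ _ → 0) (∉⇒disjoint-⁅⁆ k∉x s∈x) (x≢y⇒x∉⁅y⁆ a≢k) refl))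

  discrete-∪-isJoin : ∀ {S T : Subset n} (s : ∃ (_∈ S)) (t : ∃ (_∈ T)) →
    IsJoin (emb (discrete (S ∪ T) (proj₁ s , p⊆p∪q T (proj₂ s))))
           (emb (discrete S s)) (emb (discrete T t))
  discrete-∪-isJoin {S} {T} s t =
    ⊑-discrete {s = s} (discrete S∪T s′) (p⊆p∪q T)
    , ⊑-discrete {s = t} (discrete S∪T s′) (q⊆p∪q S T)
    , least
    where
    S∪T = S ∪ T
    s′ : ∃ (_∈ S∪T)
    s′ = proj₁ s , p⊆p∪q T (proj₂ s)
    least : ∀ z → emb (discrete S s) ⊑ z → emb (discrete T t) ⊑ z →
            emb (discrete S∪T s′) ⊑ z
    least (emb e) (S⊆e , _) (T⊆e , _) =
      ⊑-discrete {s = s′} e (λ a∈S∪T → [ S⊆e , T⊆e ] (x∈p∪q⁻ S T a∈S∪T))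

module AdditiveGame {c ℓ : Level} (G : AbelianGroup c ℓ) {n : ℕ}
                    (v : C⊥ n → AbelianGroup.Carrier G)
                    (game : IsGame G v) (additive : IsAdditive G v) where

  open AbelianGroup G
  open import Algebra.Properties.Group group using (∙-cancelʳ; identityʳ-unique)
  open import Relation.Binary.Reasoning.Setoid setoid

  isJoin-bot⇒≈∙ : ∀ {j x y} → IsJoin j x y → IsMeet bot x y → v j ≈ v x ∙ v y
  isJoin-bot⇒≈∙ {j} {x} {y} join meet = begin
    v j         ≈⟨ identityʳ (v j) ⟨
    v j ∙ ε     ≈⟨ ∙-congˡ game ⟨
    v j ∙ v bot ≈⟨ additive x y j bot join meet ⟩
    v x ∙ v y   ∎

  full⇒≈top : ∀ t {e} → (∀ a → a ∈ set e) → v (emb e) ≈ v (emb (top t))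
  full⇒≈top t {e} full = sym (∙-cancelʳ (v (emb e)) _ _
    (additive (emb e) (emb e) (emb (top t)) (emb e)
              (full⇒isJoin-top t full) (⊑-refl (emb e) , ⊑-refl (emb e) , λ _ z⊑e _ → z⊑e)))

  top≈∙split : ∀ t {x k} → k ∉ set x → v (emb (top t)) ≈ v (emb x) ∙ v (emb (split k))
  top≈∙split t k∉x =
    isJoin-bot⇒≈∙ (∉⇒isJoin-top t k∉x)
      (disjoint⇒isMeet-bot (∉⇒disjoint-⁅⁆ k∉x))

  pair≈∙ : ∀ {i j} → i ≢ j →
           v (emb (pair i j)) ≈ v (emb (singleton i)) ∙ v (emb (singleton j))
  pair≈∙ {i} {j} i≢j =
    isJoin-bot⇒≈∙ (discrete-∪-isJoin _ _)
      (disjoint⇒isMeet-bot (≢⇒disjoint-⁅⁆ i≢j))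

  splits-vanish⇒vanishes : ∀ t → v (emb (top t)) ≈ ε → (∀ k → v (emb (split k)) ≈ ε) →
                           ∀ x → v x ≈ ε
  splits-vanish⇒vanishes t top≈ε split≈ε bot = game
  splits-vanish⇒vanishes t top≈ε split≈ε (emb e) with all? (_∈? set e)
  ... | yes full = trans (full⇒≈top t full) top≈ε
  ... | no ¬full with ¬∀⟶∃¬ n (_∈ set e) (_∈? set e) ¬full
  ...   | k , k∉e = begin
    v (emb e)                     ≈⟨ identityʳ _ ⟨
    v (emb e) ∙ ε                 ≈⟨ ∙-congˡ (split≈ε k) ⟨
    v (emb e) ∙ v (emb (split k)) ≈⟨ top≈∙split t k∉e ⟨
    v (emb (top t))               ≈⟨ top≈ε ⟩
    ε                             ∎

  module _ {p q r : Fin n} (p≢q : p ≢ q) (q≢r : q ≢ r) (p≢r : p ≢ r) where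

    private
      F : Carrier
      F = v (emb (top p))
      a : Fin n → Carrier
      a k = v (emb (split k))
      w : Fin n → Carrier
      w i = v (emb (singleton i))

    singleton≈ε : w q ≈ ε
    singleton≈ε = identityʳ-unique (w p) (w q) (∙-cancelʳ (a r) _ _ (begin
      (w p ∙ w q) ∙ a r        ≈⟨ ∙-congʳ (pair≈∙ p≢q) ⟨
      v (emb (pair p q)) ∙ a r ≈⟨ top≈∙split p r∉pair ⟨
      F                        ≈⟨ top≈∙split p (x≢y⇒x∉⁅y⁆ (p≢r ∘ ≡.sym)) ⟩
      w p ∙ a r                ∎))
      where
      r∉pair : r ∉ ⁅ p ⁆ ∪ ⁅ q ⁆
      r∉pair = [ x≢y⇒x∉⁅y⁆ (p≢r ∘ ≡.sym) , x≢y⇒x∉⁅y⁆ (q≢r ∘ ≡.sym) ] ∘ x∈p∪q⁻ ⁅ p ⁆ ⁅ q ⁆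

    split≈top : ∀ {k} → k ≢ q → a k ≈ F
    split≈top {k} k≢q = begin
      a k         ≈⟨ identityˡ (a k) ⟨
      ε ∙ a k     ≈⟨ ∙-congʳ singleton≈ε ⟨
      w q ∙ a k   ≈⟨ top≈∙split p (x≢y⇒x∉⁅y⁆ k≢q) ⟨
      F           ∎

    top≈ε : F ≈ ε
    top≈ε = identityʳ-unique F F (begin
      F ∙ F       ≈⟨ ∙-cong (split≈top p≢q) (split≈top (q≢r ∘ ≡.sym)) ⟨
      a p ∙ a r   ≈⟨ top≈∙split p (x≢y⇒x∉⁅y⁆ (p≢r ∘ ≡.sym)) ⟨
      F           ∎)

    split≈ε : ∀ k → a k ≈ ε
    split≈ε k with k ≟ q
    ... | no k≢q   = trans (split≈top k≢q) top≈ε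
    ... | yes refl = begin
      a q         ≈⟨ identityˡ (a q) ⟨
      ε ∙ a q     ≈⟨ ∙-congʳ (trans (split≈top p≢q) top≈ε) ⟨
      a p ∙ a q   ≈⟨ top≈∙split p (x≢y⇒x∉⁅y⁆ (p≢q ∘ ≡.sym)) ⟨
      F           ≈⟨ top≈ε ⟩
      ε           ∎

    vanishes : ∀ x → v x ≈ ε
    vanishes = splits-vanish⇒vanishes p top≈ε split≈ε

corollary1 : ∀ {c ℓ : Level} (G : AbelianGroup c ℓ) → TorsionFree G →
    (n : ℕ) → 2 < n →
    (v : C⊥ n → AbelianGroup.Carrier G) → IsGame G v → IsAdditive G v →
    ∀ (x : C⊥ n) → AbelianGroup._≈_ G (v x) (AbelianGroup.ε G)
corollary1 G _ (suc (suc (suc _))) (s≤s (s≤s (s≤s _))) v game additive =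
  AdditiveGame.vanishes G v game additive
    {fzero} {fsuc fzero} {fsuc (fsuc fzero)} (λ ()) (λ ()) (λ ())
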